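{- For every term $f\colon A\vdash B$ there is a derivation of $A\vdash B$ in $\mathcal{IL}$ whose code is a term equal to $f$.
   Context: Formulae are built from an infinite set of propositional letters and a constant $I$ using binary connectives $\otimes$ and $\to$. An $\alpha$-formula is a formula considered up to strict associativity of $\otimes$ and strict unitality of $I$ ($A\otimes(B\otimes C)=(A\otimes B)\otimes C$, $A\otimes I=I\otimes A=A$, also inside subformulae). System $\mathcal{IL}$: sequents $G\vdash A$ with $G,A$ $\alpha$-formulae. Axioms $A\vdash A$. Rules (letters denote $\alpha$-formulae, possibly $I$): interchange: from $G\otimes A\otimes B\otimes E\vdash D$ infer $G\otimes B\otimes A\otimes E\vdash D$; cut: from $C\vdash A$ and $G\otimes A\otimes E\vdash D$ infer $G\otimes C\otimes E\vdash D$; $(\to\vdash)$: from $C\vdash A$ and $B\otimes G\vdash D$ infer $C\otimes(A\to B)\otimes G\vdash D$; $(\vdash\to)$: from $A\otimes G\vdash C$ infer $G\vdash A\to C$; $(\otimes\vdash\otimes)$: from $A\vdash C$ and $B\vdash E$ infer $A\otimes B\vdash C\otimes E$. Terms with types $f\colon A\vdash B$: primitive $\mathbf 1_A\colon A\vdash A$, $c_{B,A}\colon B\otimes A\vdash A\otimes B$, $\eta_{A,B}\colon B\vdash A\to(A\otimes B)$, $\varepsilon_{A,B}\colon A\otimes(A\to B)\vdash B$; closed under $g\circ f$ (for $f\colon A\vdash B$, $g\colon B\vdash C$), $f_1\otimes f_2\colon A_1\otimes A_2\vdash B_1\otimes B_2$, and $A\to f\colon A\to B_1\vdash A\to B_2$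 (for $f\colon B_1\vdash B_2$); strictly $f\otimes(g\otimes h)=(f\otimes g)\otimes h$, $f\otimes\mathbf 1_I=\mathbf 1_I\otimes f=f$. Equality of terms is the smallest congruence (w.r.t. $\circ,\otimes,A\to$; only between terms of the same type) containing: $g\circ\mathbf 1_A=g$, $\mathbf 1_A\circ f=f$; $h\circ(g\circ f)=(h\circ g)\circ f$; $\mathbf 1_A\otimes\mathbf 1_B=\mathbf 1_{A\otimes B}$; $(g_1\otimes g_2)\circ(f_1\otimes f_2)=(g_1\circ f_1)\otimes(g_2\circ f_2)$; $c_{A',B'}\circ(f\otimes g)=(g\otimes f)\circ c_{A,B}$ ($f\colon A\vdash A'$, $g\colon B\vdash B'$); $c_{B,A}\circ c_{A,B}=\mathbf 1_{A\otimes B}$; $c_{A\otimes B,C}=(c_{A,C}\otimes\mathbf 1_B)\circ(\mathbf 1_A\otimes c_{B,C})$; $A\to(g\circ f)=(A\to g)\circ(A\to f)$; $\eta_{A,B'}\circ f=(A\to(\mathbf 1_A\otimes f))\circ\eta_{A,B}$ ($f\colon B\vdash B'$); $A\to\mathbf 1_B=\mathbf 1_{A\to B}$; $\varepsilon_{A,B'}\circ(\mathbf 1_A\otimes(A\to f))=f\circ\varepsilon_{A,B}$ ($f\colon B\vdash B'$); $\varepsilon_{A,A\otimes B}\circ(\mathbf 1_A\otimes\eta_{A,B})=\mathbf 1_{A\otimes B}$; $(A\to\varepsilon_{A,B})\circ\eta_{A,A\to B}=\mathbf 1_{A\to B}$. Coding of derivations: an axiom $A\vdash A$ is coded by $\mathbf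 1_A$; if the premises are coded by $f$ (and $g$): interchange gives $f\circ(\mathbf 1_G\otimes c_{B,A}\otimes\mathbf 1_E)$; cut (left premise $f\colon C\vdash A$, right $g$) gives $g\circ(\mathbf 1_G\otimes f\otimes\mathbf 1_E)$; $(\to\vdash)$ with $f\colon C\vdash A$, $g\colon B\otimes G\vdash D$ gives $g\circ(\varepsilon_{A,B}\otimes\mathbf 1_G)\circ(f\otimes\mathbf 1_{A\to B}\otimes\mathbf 1_G)$; $(\vdash\to)$ with $f\colon A\otimes G\vdash C$ gives $(A\to f)\circ\eta_{A,G}$; $(\otimes\vdash\otimes)$ gives $f\otimes g$. -}

module Defs where

open import Data.Nat using (ℕ)
open import Data.List using (List; []; _∷_; [_]; _++_)
open import Data.Product using (Σ)

-- An α-formula is a (possibly empty) ⊗-product of "factors", each factor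
-- being a propositional letter or an implication between α-formulae.  This representation
-- makes associativity of ⊗ and unitality of I strict (also inside
-- subformulae), i.e. α-formulae are compared with _≡_.

data Fac : Set where
  var  : ℕ → Fac
  _⇒_  : List Fac → List Fac → Fac

Form : Set
Form = List Fac

I : Form
I = []

_⊗_ : Form → Form → Form
A ⊗ B = A ++ B

infixr 6 _⊗_

_⟶_ : Form → Form → Form
A ⟶ B = [ A ⇒ B ]

infixr 5 _⟶_

letter : ℕ → Form
letter n = [ var n ]

-- Raw terms (annotated with formulae, so their type is determined).

data Term : Set where
  𝟏    : Form → Term
  cc   : Form → Form → Term
  η    : Form → Form → Term
  ε    : Form → Form → Term
  _∘ᵗ_ : Term → Term → Term
  _⊗ᵗ_ : Term → Term → Term
  _⇒ᵗ_ : Form → Term → Term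

infixr 7 _⊗ᵗ_
infixr 8 _∘ᵗ_

infix 4 _∶_⊢_
data _∶_⊢_ : Term → Form → Form → Set where
  t𝟏  : ∀ A → 𝟏 A ∶ A ⊢ A
  tc  : ∀ B A → cc B A ∶ B ⊗ A ⊢ A ⊗ B
  tη  : ∀ A B → η A B ∶ B ⊢ (A ⟶ (A ⊗ B))
  tε  : ∀ A B → ε A B ∶ A ⊗ (A ⟶ B) ⊢ B
  t∘  : ∀ {f g A B C} → f ∶ A ⊢ B → g ∶ B ⊢ C → (g ∘ᵗ f) ∶ A ⊢ C
  t⊗  : ∀ {f₁ f₂ A₁ A₂ B₁ B₂} → f₁ ∶ A₁ ⊢ B₁ → f₂ ∶ A₂ ⊢ B₂ →
        (f₁ ⊗ᵗ f₂) ∶ A₁ ⊗ A₂ ⊢ B₁ ⊗ B₂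
  t⇒  : ∀ A {f B₁ B₂} → f ∶ B₁ ⊢ B₂ → (A ⇒ᵗ f) ∶ (A ⟶ B₁) ⊢ (A ⟶ B₂)

-- The strict identities
-- f⊗(g⊗h)=(f⊗g)⊗h and f⊗1_I = 1_I⊗f = f on terms are included as
-- generating equations (this yields the same identification of terms).
data TEq : Form → Form → Term → Term → Set where
  ≈refl  : ∀ {A B f} → f ∶ A ⊢ B → TEq A B f f
  ≈sym   : ∀ {A B f g} → TEq A B f g → TEq A B g f
  ≈trans : ∀ {A B f g h} → TEq A B f g → TEq A B g h → TEq A B f h
  ≈∘     : ∀ {A B C f f' g g'} → TEq A B f f' → TEq B C g g' →
           TEq A C (g ∘ᵗ f) (g' ∘ᵗ f')
  ≈⊗     : ∀ {A₁ A₂ B₁ B₂ f₁ f₁' f₂ f₂'} → TEq A₁ B₁ f₁ f₁' → TEq A₂ B₂ f₂ f₂' →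
           TEq (A₁ ⊗ A₂) (B₁ ⊗ B₂) (f₁ ⊗ᵗ f₂) (f₁' ⊗ᵗ f₂')
  ≈⇒     : ∀ A {B₁ B₂ f f'} → TEq B₁ B₂ f f' →
           TEq (A ⟶ B₁) (A ⟶ B₂) (A ⇒ᵗ f) (A ⇒ᵗ f')
  s-assoc : ∀ {A₁ A₂ A₃ B₁ B₂ B₃ f g h} →
            f ∶ A₁ ⊢ B₁ → g ∶ A₂ ⊢ B₂ → h ∶ A₃ ⊢ B₃ →
            TEq (A₁ ⊗ A₂ ⊗ A₃) (B₁ ⊗ B₂ ⊗ B₃) (f ⊗ᵗ (g ⊗ᵗ h)) ((f ⊗ᵗ g) ⊗ᵗ h)
  s-unitʳ : ∀ {A B f} → f ∶ A ⊢ B → TEq A B (f ⊗ᵗ 𝟏 I) f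
  s-unitˡ : ∀ {A B f} → f ∶ A ⊢ B → TEq A B (𝟏 I ⊗ᵗ f) f
  idʳ    : ∀ {A B g} → g ∶ A ⊢ B → TEq A B (g ∘ᵗ 𝟏 A) g
  idˡ    : ∀ {A B f} → f ∶ A ⊢ B → TEq A B (𝟏 B ∘ᵗ f) f
  ∘assoc : ∀ {A B C D f g h} → f ∶ A ⊢ B → g ∶ B ⊢ C → h ∶ C ⊢ D →
           TEq A D (h ∘ᵗ (g ∘ᵗ f)) ((h ∘ᵗ g) ∘ᵗ f)
  ⊗id    : ∀ A B → TEq (A ⊗ B) (A ⊗ B) (𝟏 A ⊗ᵗ 𝟏 B) (𝟏 (A ⊗ B))
  ⊗∘     : ∀ {A₁ A₂ B₁ B₂ C₁ C₂ f₁ f₂ g₁ g₂} →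
           f₁ ∶ A₁ ⊢ B₁ → f₂ ∶ A₂ ⊢ B₂ → g₁ ∶ B₁ ⊢ C₁ → g₂ ∶ B₂ ⊢ C₂ →
           TEq (A₁ ⊗ A₂) (C₁ ⊗ C₂) ((g₁ ⊗ᵗ g₂) ∘ᵗ (f₁ ⊗ᵗ f₂)) ((g₁ ∘ᵗ f₁) ⊗ᵗ (g₂ ∘ᵗ f₂))
  c-nat  : ∀ {A A' B B' f g} → f ∶ A ⊢ A' → g ∶ B ⊢ B' →
           TEq (A ⊗ B) (B' ⊗ A') (cc A' B' ∘ᵗ (f ⊗ᵗ g)) ((g ⊗ᵗ f) ∘ᵗ cc A B)
  c-inv  : ∀ A B → TEq (A ⊗ B) (A ⊗ B) (cc B A ∘ᵗ cc A B) (𝟏 (A ⊗ B))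
  c-hex  : ∀ A B C → TEq (A ⊗ B ⊗ C) (C ⊗ A ⊗ B)
           (cc (A ⊗ B) C) ((cc A C ⊗ᵗ 𝟏 B) ∘ᵗ (𝟏 A ⊗ᵗ cc B C))
  ⇒∘     : ∀ A {B₁ B₂ B₃ f g} → f ∶ B₁ ⊢ B₂ → g ∶ B₂ ⊢ B₃ →
           TEq (A ⟶ B₁) (A ⟶ B₃) (A ⇒ᵗ (g ∘ᵗ f)) ((A ⇒ᵗ g) ∘ᵗ (A ⇒ᵗ f))
  η-nat  : ∀ A {B B' f} → f ∶ B ⊢ B' →
           TEq B (A ⟶ (A ⊗ B')) (η A B' ∘ᵗ f) ((A ⇒ᵗ (𝟏 A ⊗ᵗ f)) ∘ᵗ η A B)
  ⇒id    : ∀ A B → TEq (A ⟶ B) (A ⟶ B) (A ⇒ᵗ 𝟏 B) (𝟏 (A ⟶ B))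
  ε-nat  : ∀ A {B B' f} → f ∶ B ⊢ B' →
           TEq (A ⊗ (A ⟶ B)) B' (ε A B' ∘ᵗ (𝟏 A ⊗ᵗ (A ⇒ᵗ f))) (f ∘ᵗ ε A B)
  tri₁   : ∀ A B → TEq (A ⊗ B) (A ⊗ B) (ε A (A ⊗ B) ∘ᵗ (𝟏 A ⊗ᵗ η A B)) (𝟏 (A ⊗ B))
  tri₂   : ∀ A B → TEq (A ⟶ B) (A ⟶ B) ((A ⇒ᵗ ε A B) ∘ᵗ η A (A ⟶ B)) (𝟏 (A ⟶ B))

data _⊢ᴵᴸ_ : Form → Form → Set where
  ax    : ∀ A → A ⊢ᴵᴸ A
  inter : ∀ G A B E D → (G ⊗ A ⊗ B ⊗ E) ⊢ᴵᴸ D → (G ⊗ B ⊗ A ⊗ E) ⊢ᴵᴸ D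
  cut   : ∀ G C A E D → C ⊢ᴵᴸ A → (G ⊗ A ⊗ E) ⊢ᴵᴸ D → (G ⊗ C ⊗ E) ⊢ᴵᴸ D
  →⊢    : ∀ C A B G D → C ⊢ᴵᴸ A → (B ⊗ G) ⊢ᴵᴸ D → (C ⊗ (A ⟶ B) ⊗ G) ⊢ᴵᴸ D
  ⊢→    : ∀ A G C → (A ⊗ G) ⊢ᴵᴸ C → G ⊢ᴵᴸ (A ⟶ C)
  ⊗⊢⊗   : ∀ A B C E → A ⊢ᴵᴸ C → B ⊢ᴵᴸ E → (A ⊗ B) ⊢ᴵᴸ (C ⊗ E)

infix 4 _⊢ᴵᴸ_

code : ∀ {G D} → G ⊢ᴵᴸ D → Term
code (ax A)              = 𝟏 A
code (inter G A B E D d) = code d ∘ᵗ (𝟏 G ⊗ᵗ cc B A ⊗ᵗ 𝟏 E)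
code (cut G C A E D f g) = code g ∘ᵗ (𝟏 G ⊗ᵗ code f ⊗ᵗ 𝟏 E)
code (→⊢ C A B G D f g)  =
  code g ∘ᵗ ((ε A B ⊗ᵗ 𝟏 G) ∘ᵗ (code f ⊗ᵗ 𝟏 (A ⟶ B) ⊗ᵗ 𝟏 G))
code (⊢→ A G C f)        = (A ⇒ᵗ code f) ∘ᵗ η A G
code (⊗⊢⊗ A B C E f g)   = code f ⊗ᵗ code g

{-# OPTIONS --safe #-}
module Submission where

open import Defs
open import Data.Product using (Σ; _,_)
open import Data.List.Properties using (++-assoc; ++-identityʳ)
open import Relation.Binary.PropositionalEquality using (_≡_; refl; sym; cong)
import Relation.Binary.Reasoning.Base.Partial as PartialReasoning

-- Each primitive and each term
-- constructor is matched by a (derived) rule of IL whose code is that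
-- primitive or constructor applied to the codes of the premises: c by
-- interchange, η by (⊢→), ε by (→⊢), ∘ by cut, ⊗ by (⊗⊢⊗).  The one
-- indirect case is A → f, derived by (→⊢) followed by (⊢→); its code
-- (A → (f ∘ ε)) ∘ η equals A → f by the triangle law (A → ε) ∘ η = 1.

retype : ∀ {f A A' B B'} → A ≡ A' → B ≡ B' → f ∶ A ⊢ B → f ∶ A' ⊢ B'
retype refl refl t = t

castᴵᴸ : ∀ {G G' D} → G ≡ G' → G ⊢ᴵᴸ D → G' ⊢ᴵᴸ D
castᴵᴸ refl d = d

code-castᴵᴸ : ∀ {G G' D} (p : G ≡ G') (d : G ⊢ᴵᴸ D) → code (castᴵᴸ p d) ≡ code d
code-castᴵᴸ refl d = refl

code-typed : ∀ {G D} (d : G ⊢ᴵᴸ D) → code d ∶ G ⊢ D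
code-typed (ax A) = t𝟏 A
code-typed (inter G A B E D d) =
  t∘ (retype (cong (G ⊗_) (++-assoc B A E)) (cong (G ⊗_) (++-assoc A B E))
        (t⊗ (t𝟏 G) (t⊗ (tc B A) (t𝟏 E))))
     (code-typed d)
code-typed (cut G C A E D f g) =
  t∘ (t⊗ (t𝟏 G) (t⊗ (code-typed f) (t𝟏 E))) (code-typed g)
code-typed (→⊢ C A B G D f g) =
  t∘ (t∘ (t⊗ (code-typed f) (t⊗ (t𝟏 (A ⟶ B)) (t𝟏 G)))
         (retype (++-assoc A (A ⟶ B) G) refl (t⊗ (tε A B) (t𝟏 G))))
     (code-typed g)
code-typed (⊢→ A G C f) = t∘ (tη A G) (t⇒ A (code-typed f))
code-typed (⊗⊢⊗ A B C E f g) = t⊗ (code-typed f) (code-typed g)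

module TEq-Reasoning {A B : Form} = PartialReasoning (TEq A B) ≈trans

-- The padded term has type C ⊗ I ⊢ A ⊗ I, equal to C ⊢ A only propositionally.
⊗-𝟏I-identity : ∀ {h C A} → h ∶ C ⊢ A → TEq C A (𝟏 I ⊗ᵗ h ⊗ᵗ 𝟏 I) h
⊗-𝟏I-identity th =
  ≈trans (s-unitˡ (retype (++-identityʳ _) (++-identityʳ _) (t⊗ th (t𝟏 I))))
         (s-unitʳ th)

⇒ᵗ-transpose : ∀ A {f B₁ B₂} → f ∶ B₁ ⊢ B₂ →
               TEq (A ⟶ B₁) (A ⟶ B₂) ((A ⇒ᵗ (f ∘ᵗ ε A B₁)) ∘ᵗ η A (A ⟶ B₁)) (A ⇒ᵗ f)
⇒ᵗ-transpose A {f} {B₁} tf = begin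
  (A ⇒ᵗ (f ∘ᵗ ε A B₁)) ∘ᵗ η A (A ⟶ B₁)
    ∼⟨ ≈∘ (≈refl (tη A (A ⟶ B₁))) (⇒∘ A (tε A B₁) tf) ⟩
  ((A ⇒ᵗ f) ∘ᵗ (A ⇒ᵗ ε A B₁)) ∘ᵗ η A (A ⟶ B₁)
    ∼⟨ ≈sym (∘assoc (tη A (A ⟶ B₁)) (t⇒ A (tε A B₁)) (t⇒ A tf)) ⟩
  (A ⇒ᵗ f) ∘ᵗ ((A ⇒ᵗ ε A B₁) ∘ᵗ η A (A ⟶ B₁))
    ∼⟨ ≈∘ (tri₂ A B₁) (≈refl (t⇒ A tf)) ⟩
  (A ⇒ᵗ f) ∘ᵗ 𝟏 (A ⟶ B₁)
    ∼⟨ idʳ (t⇒ A tf) ⟩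
  A ⇒ᵗ f ∎
  where open TEq-Reasoning

exchᴵᴸ : ∀ A B {D} → A ⊗ B ⊢ᴵᴸ D → B ⊗ A ⊢ᴵᴸ D
exchᴵᴸ A B {D} d =
  castᴵᴸ (cong (B ⊗_) (++-identityʳ A))
    (inter I A B I D (castᴵᴸ (sym (cong (A ⊗_) (++-identityʳ B))) d))

code-exchᴵᴸ : ∀ A B {D} (d : A ⊗ B ⊢ᴵᴸ D) →
              TEq (B ⊗ A) D (code (exchᴵᴸ A B d)) (code d ∘ᵗ cc B A)
code-exchᴵᴸ A B {D} d
  rewrite code-castᴵᴸ (cong (B ⊗_) (++-identityʳ A))
            (inter I A B I D (castᴵᴸ (sym (cong (A ⊗_) (++-identityʳ B))) d))
        | code-castᴵᴸ (sym (cong (A ⊗_) (++-identityʳ B))) d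
  = ≈∘ (⊗-𝟏I-identity (tc B A)) (≈refl (code-typed d))

cutᴵᴸ : ∀ {C A D} → C ⊢ᴵᴸ A → A ⊢ᴵᴸ D → C ⊢ᴵᴸ D
cutᴵᴸ {C} {A} {D} f g =
  castᴵᴸ (++-identityʳ C) (cut I C A I D f (castᴵᴸ (sym (++-identityʳ A)) g))

code-cutᴵᴸ : ∀ {C A D} (f : C ⊢ᴵᴸ A) (g : A ⊢ᴵᴸ D) →
             TEq C D (code (cutᴵᴸ f g)) (code g ∘ᵗ code f)
code-cutᴵᴸ {C} {A} {D} f g
  rewrite code-castᴵᴸ (++-identityʳ C) (cut I C A I D f (castᴵᴸ (sym (++-identityʳ A)) g))
        | code-castᴵᴸ (sym (++-identityʳ A)) g
  = ≈∘ (⊗-𝟏I-identity (code-typed f)) (≈refl (code-typed g))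

evalᴵᴸ : ∀ A {B D} → B ⊢ᴵᴸ D → A ⊗ (A ⟶ B) ⊢ᴵᴸ D
evalᴵᴸ A {B} {D} d = →⊢ A A B I D (ax A) (castᴵᴸ (sym (++-identityʳ B)) d)

code-evalᴵᴸ : ∀ A {B D} (d : B ⊢ᴵᴸ D) →
              TEq (A ⊗ (A ⟶ B)) D (code (evalᴵᴸ A d)) (code d ∘ᵗ ε A B)
code-evalᴵᴸ A {B} d rewrite code-castᴵᴸ (sym (++-identityʳ B)) d =
  ≈∘ padded-ε (≈refl (code-typed d))
  where
  open TEq-Reasoning
  padded-ε : TEq (A ⊗ (A ⟶ B)) B ((ε A B ⊗ᵗ 𝟏 I) ∘ᵗ (𝟏 A ⊗ᵗ 𝟏 (A ⟶ B) ⊗ᵗ 𝟏 I)) (ε A B)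
  padded-ε = begin
    (ε A B ⊗ᵗ 𝟏 I) ∘ᵗ (𝟏 A ⊗ᵗ 𝟏 (A ⟶ B) ⊗ᵗ 𝟏 I)
      ∼⟨ ≈∘ (≈trans (≈⊗ (≈refl (t𝟏 A)) (s-unitʳ (t𝟏 (A ⟶ B)))) (⊗id A (A ⟶ B)))
            (s-unitʳ (tε A B)) ⟩
    ε A B ∘ᵗ 𝟏 (A ⊗ (A ⟶ B))
      ∼⟨ idʳ (tε A B) ⟩
    ε A B ∎

proposition4p3 : ∀ {A B f} → f ∶ A ⊢ B → Σ (A ⊢ᴵᴸ B) (λ d → TEq A B (code d) f)
proposition4p3 (t𝟏 A) = ax A , ≈refl (t𝟏 A)
proposition4p3 (tc B A) =
  exchᴵᴸ A B (ax (A ⊗ B)) , ≈trans (code-exchᴵᴸ A B (ax (A ⊗ B))) (idˡ (tc B A))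
proposition4p3 (tη A B) =
  ⊢→ A B (A ⊗ B) (ax (A ⊗ B)) ,
  ≈trans (≈∘ (≈refl (tη A B)) (⇒id A (A ⊗ B))) (idˡ (tη A B))
proposition4p3 (tε A B) =
  evalᴵᴸ A (ax B) , ≈trans (code-evalᴵᴸ A (ax B)) (idˡ (tε A B))
proposition4p3 (t∘ tf tg) with proposition4p3 tf | proposition4p3 tg
... | d₁ , e₁ | d₂ , e₂ = cutᴵᴸ d₁ d₂ , ≈trans (code-cutᴵᴸ d₁ d₂) (≈∘ e₁ e₂)
proposition4p3 (t⊗ tf tg) with proposition4p3 tf | proposition4p3 tg
... | d₁ , e₁ | d₂ , e₂ = ⊗⊢⊗ _ _ _ _ d₁ d₂ , ≈⊗ e₁ e₂
proposition4p3 (t⇒ A {B₁ = B₁} {B₂} tf) with proposition4p3 tf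
... | d , e =
  ⊢→ A (A ⟶ B₁) B₂ (evalᴵᴸ A d) ,
  ≈trans (≈∘ (≈refl (tη A (A ⟶ B₁)))
              (≈⇒ A (≈trans (code-evalᴵᴸ A d) (≈∘ (≈refl (tε A B₁)) e))))
         (⇒ᵗ-transpose A tf)
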